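{- Let $f\colon[0,1]\to[0,1]$ be computed by a finite-state transducer for the standard binary representation. Then $f$ maps rationals to rationals, i.e. $f(\mathbb{Q}\cap[0,1])\subseteq\mathbb{Q}$.
   Context: Standard binary representation: $\alpha\in\{0,1\}^\omega$ represents $\sum_s\alpha(s)2^{ -s-1}$. A (possibly nondeterministic) finite-state transducer with delay $D$ has finitely many states, an initial state and a transition relation; it reads input bits one at a time, writes nothing while reading the first $D$ bits, and thereafter writes exactly one output bit per input bit; runs may die. It computes $f$ if for every $x\in[0,1]$ and every binary representation $\alpha$ of $x$, there is an infinite run on $\alpha$ and every infinite run on $\alpha$ writes a binary representation of $f(x)$. -}

module Defs where

open import Data.Nat using (ℕ; zero; suc; _+_; _*_; _^_; _≤_; _<_)
open import Data.Bool using (Bool; true; false; if_then_else_)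
open import Data.Maybe using (Maybe; just; nothing)
open import Data.Fin using (Fin)
open import Data.Product using (Σ; _×_; ∃)
open import Relation.Binary.PropositionalEquality using (_≡_)

Stream : Set
Stream = ℕ → Bool

bit : Bool → ℕ
bit true  = 1
bit false = 0

-- num α n = Σ_{s<n} α(s) 2^(n-1-s), i.e. the n-th partial sum
-- Σ_{s<n} α(s) 2^(-s-1) of the represented value, scaled by 2^n.
num : Stream → ℕ → ℕ
num α zero    = 0
num α (suc n) = 2 * num α n + bit (α n)

-- α and β are binary representations of the same real number in [0,1].
-- (Both values lie in [num_n/2^n, (num_n+1)/2^n]; so equal values give
-- |num α n - num β n| ≤ 1 for all n, and conversely this forces the values
-- to differ by at most 2^(1-n) for every n.)
SameValue : Stream → Stream → Set
SameValue α β = ∀ n → (num α n ≤ num β n + 1) × (num β n ≤ num α n + 1)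

RepresentsRational : Stream → ℕ → ℕ → Set
RepresentsRational α p q =
  (0 < q) × (∀ n → (num α n * q ≤ p * 2 ^ n) × (p * 2 ^ n ≤ (num α n + 1) * q))

IsRationalValue : Stream → Set
IsRationalValue α = Σ ℕ λ p → Σ ℕ λ q → RepresentsRational α p q

-- Transition (r , b , o , r') with input bit b and output o
-- (nothing = writes no bit, just c = writes bit c) is allowed iff
-- trans r b o r' ≡ true.
record Transducer : Set where
  field
    nStates : ℕ
    init    : Fin nStates
    delay   : ℕ
    trans   : Fin nStates → Bool → Maybe Bool → Fin nStates → Bool

open Transducer public

record Run (T : Transducer) (α : Stream) (ω : Stream) : Set where
  field
    state   : ℕ → Fin (nStates T)
    start   : state 0 ≡ init T
    silent  : ∀ t → t < delay T →
              trans T (state t) (α t) nothing (state (suc t)) ≡ true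
    writing : ∀ s →
              trans T (state (delay T + s)) (α (delay T + s)) (just (ω s))
                      (state (suc (delay T + s))) ≡ true

-- A function f : [0,1] → [0,1], given on binary representations
-- (f α is a binary representation of f(x) where α represents x); it must be
-- well defined on reals, i.e. respect SameValue.
IsRealFunction : (Stream → Stream) → Set
IsRealFunction f = ∀ α β → SameValue α β → SameValue (f α) (f β)

Computes : Transducer → (Stream → Stream) → Set
Computes T f =
  ∀ α → (Σ Stream λ ω → Run T α ω) × (∀ ω → Run T α ω → SameValue ω (f α))

module Submission where

-- If α represents p/q, long division yields another representation of p/q whose
-- digits are driven by remainders in {0, …, q}. Pigeonhole on (remainder, state)
-- gives two times after the delay at which both repeat; looping the run of the
-- transducer between them yields a run whose output is eventually periodic, hence
-- represents a rational P/Q. That output and f α represent the same real, so their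
-- n-th partial sums differ by at most 2 for every n, and an error that bounded
-- disappears after rescaling: f α represents P/Q as well.

open import Defs
open import Data.Nat
open import Data.Nat.Properties
open import Data.Nat.Tactic.RingSolver using (solve-∀)
open import Algebra.Properties.CommutativeSemigroup *-commutativeSemigroup
  using (x∙yz≈y∙xz; xy∙z≈xz∙y)
open import Data.Bool using (Bool; true; false)
open import Data.Maybe using (just; nothing)
open import Data.Fin using (Fin; combine; fromℕ<; toℕ)
import Data.Fin.Properties as Fin
open import Data.Product
open import Relation.Nullary using (yes; no; contradiction)
open import Relation.Nullary.Reflects using (ofʸ; ofⁿ)
open import Function using (_∘_)
open import Relation.Binary.PropositionalEquality hiding (trans)
import Relation.Binary.PropositionalEquality as ≡

drop : ℕ → Stream → Stream
drop i γ s = γ (i + s)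

bit≤1 : ∀ b → bit b ≤ 1
bit≤1 true  = ≤-refl
bit≤1 false = z≤n

num-cong : ∀ {γ δ} → (∀ t → γ t ≡ δ t) → ∀ n → num γ n ≡ num δ n
num-cong γ≗δ zero    = refl
num-cong γ≗δ (suc n) = cong₂ (λ x b → 2 * x + bit b) (num-cong γ≗δ n) (γ≗δ n)

num<2^n : ∀ γ n → num γ n < 2 ^ n
num<2^n γ zero    = z<s
num<2^n γ (suc n) = begin-strict
  2 * x + bit (γ n)  ≤⟨ +-monoʳ-≤ (2 * x) (bit≤1 (γ n)) ⟩
  2 * x + 1          <⟨ n<1+n (2 * x + 1) ⟩
  suc (2 * x + 1)    ≡⟨ double-suc x ⟩
  2 * suc x          ≤⟨ *-monoʳ-≤ 2 (num<2^n γ n) ⟩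
  2 * 2 ^ n          ∎
  where
    open ≤-Reasoning
    x : ℕ
    x = num γ n
    double-suc : ∀ x → suc (2 * x + 1) ≡ 2 * suc x
    double-suc = solve-∀

n<2^n : ∀ n → n < 2 ^ n
n<2^n zero    = z<s
n<2^n (suc n) = begin-strict
  suc n        ≤⟨ n<2^n n ⟩
  2 ^ n        <⟨ m<m+n (2 ^ n) (m^n>0 2 n) ⟩
  2 ^ n + 2 ^ n ≡⟨ cong (2 ^ n +_) (sym (+-identityʳ (2 ^ n))) ⟩
  2 * 2 ^ n    ∎
  where open ≤-Reasoning

num-+ : ∀ γ m n → num γ (m + n) ≡ 2 ^ n * num γ m + num (drop m γ) n
num-+ γ m zero    = begin
  num γ (m + 0)   ≡⟨ cong (num γ) (+-identityʳ m) ⟩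
  num γ m         ≡⟨ sym (*-identityˡ (num γ m)) ⟩
  1 * num γ m     ≡⟨ sym (+-identityʳ (1 * num γ m)) ⟩
  1 * num γ m + 0 ∎
  where open ≡-Reasoning
num-+ γ m (suc n) = begin
  num γ (m + suc n)                             ≡⟨ cong (num γ) (+-suc m n) ⟩
  2 * num γ (m + n) + bit (γ (m + n))           ≡⟨ cong (λ y → 2 * y + bit (γ (m + n))) (num-+ γ m n) ⟩
  2 * (2 ^ n * x + y) + bit (γ (m + n))         ≡⟨ regroup (2 ^ n) x y (bit (γ (m + n))) ⟩
  2 * 2 ^ n * x + (2 * y + bit (γ (m + n)))     ∎
  where
    open ≡-Reasoning
    x y : ℕ
    x = num γ m
    y = num (drop m γ) n
    regroup : ∀ c x y b → 2 * (c * x + y) + b ≡ 2 * c * x + (2 * y + b)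
    regroup = solve-∀

num-+-lower : ∀ γ m n → 2 ^ n * num γ m ≤ num γ (m + n)
num-+-lower γ m n = subst (2 ^ n * num γ m ≤_) (sym (num-+ γ m n)) (m≤m+n _ _)

num-+-upper : ∀ γ m n → num γ (m + n) + 1 ≤ 2 ^ n * (num γ m + 1)
num-+-upper γ m n = begin
  num γ (m + n) + 1   ≡⟨ cong (_+ 1) (num-+ γ m n) ⟩
  d * x + y + 1       ≡⟨ +-assoc (d * x) y 1 ⟩
  d * x + (y + 1)     ≤⟨ +-monoʳ-≤ (d * x) (subst (_≤ d) (+-comm 1 y) (num<2^n (drop m γ) n)) ⟩
  d * x + d           ≡⟨ distrib-suc d x ⟩
  d * (x + 1)         ∎
  where
    open ≤-Reasoning
    distrib-suc : ∀ d x → d * x + d ≡ d * (x + 1)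
    distrib-suc = solve-∀
    d x y : ℕ
    d = 2 ^ n
    x = num γ m
    y = num (drop m γ) n

Bracket : Stream → ℕ → ℕ → ℕ → Set
Bracket γ p q n = (num γ n * q ≤ p * 2 ^ n) × (p * 2 ^ n ≤ (num γ n + 1) * q)

bracket-cong : ∀ {γ δ} p q → (∀ t → γ t ≡ δ t) → ∀ n → Bracket γ p q n → Bracket δ p q n
bracket-cong p q γ≗δ n =
  subst (λ x → (x * q ≤ p * 2 ^ n) × (p * 2 ^ n ≤ (x + 1) * q)) (num-cong γ≗δ n)

bracket-pred : ∀ γ p q n → Bracket γ p q (suc n) → Bracket γ p q n
bracket-pred γ p q n (lower , upper) = *-cancelˡ-≤ 2 lower′ , *-cancelˡ-≤ 2 upper′
  where
    open ≤-Reasoning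
    x b c : ℕ
    x = num γ n
    b = bit (γ n)
    c = 2 ^ n
    lower′ : 2 * (x * q) ≤ 2 * (p * c)
    lower′ = begin
      2 * (x * q)        ≡⟨ sym (*-assoc 2 x q) ⟩
      2 * x * q          ≤⟨ *-monoˡ-≤ q (m≤m+n (2 * x) b) ⟩
      (2 * x + b) * q    ≤⟨ lower ⟩
      p * (2 * c)        ≡⟨ x∙yz≈y∙xz p 2 c ⟩
      2 * (p * c)        ∎
    upper′ : 2 * (p * c) ≤ 2 * ((x + 1) * q)
    upper′ = begin
      2 * (p * c)          ≡⟨ sym (x∙yz≈y∙xz p 2 c) ⟩
      p * (2 * c)          ≤⟨ upper ⟩
      (2 * x + b + 1) * q  ≤⟨ *-monoˡ-≤ q (+-monoˡ-≤ 1 (+-monoʳ-≤ (2 * x) (bit≤1 (γ n)))) ⟩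
      (2 * x + 1 + 1) * q  ≡⟨ double x q ⟩
      2 * ((x + 1) * q)    ∎
      where
        double : ∀ x q → (2 * x + 1 + 1) * q ≡ 2 * ((x + 1) * q)
        double = solve-∀

bracket-+ : ∀ γ p q m n → Bracket γ p q (m + n) → Bracket γ p q n
bracket-+ γ p q zero    n br = br
bracket-+ γ p q (suc m) n br = bracket-+ γ p q m n (bracket-pred γ p q (m + n) br)

bracket-≤ : ∀ γ p q {m n} → m ≤ n → Bracket γ p q n → Bracket γ p q m
bracket-≤ γ p q {m} {n} m≤n br =
  bracket-+ γ p q (n ∸ m) m (subst (Bracket γ p q) (sym (m∸n+n≡m m≤n)) br)

bracket-scale : ∀ γ p q k n .{{_ : NonZero k}} → Bracket γ (p * k) (q * k) n → Bracket γ p q n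
bracket-scale γ p q k n (lower , upper) =
  *-cancelʳ-≤ _ _ k (subst₂ _≤_ (sym (*-assoc x q k)) (xy∙z≈xz∙y p k c) lower) ,
  *-cancelʳ-≤ _ _ k (subst₂ _≤_ (xy∙z≈xz∙y p k c) (sym (*-assoc (x + 1) q k)) upper)
  where
    x c : ℕ
    x = num γ n
    c = 2 ^ n

bracket-drop : ∀ γ i p q n → Bracket (drop i γ) p q n →
               Bracket γ (num γ i * q + p) (2 ^ i * q) (i + n)
bracket-drop γ i p q n (lower , upper) = lower′ , upper′
  where
    open ≤-Reasoning
    A x c d : ℕ
    A = num γ i
    x = num (drop i γ) n
    c = 2 ^ n
    d = 2 ^ i
    split : num γ (i + n) ≡ c * A + x
    split = num-+ γ i n
    value : (A * q + p) * 2 ^ (i + n) ≡ d * c * A * q + d * (p * c)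
    value = ≡.trans (cong ((A * q + p) *_) (^-distribˡ-+-* 2 i n)) (expand A q p d c)
      where
        expand : ∀ A q p d c → (A * q + p) * (d * c) ≡ d * c * A * q + d * (p * c)
        expand = solve-∀
    scaled : ∀ c A x d q → (c * A + x) * (d * q) ≡ d * c * A * q + d * (x * q)
    scaled = solve-∀
    scaled-suc : ∀ c A x d q → d * c * A * q + d * ((x + 1) * q) ≡ (c * A + x + 1) * (d * q)
    scaled-suc = solve-∀
    lower′ : num γ (i + n) * (d * q) ≤ (A * q + p) * 2 ^ (i + n)
    lower′ = begin
      num γ (i + n) * (d * q)         ≡⟨ cong (_* (d * q)) split ⟩
      (c * A + x) * (d * q)           ≡⟨ scaled c A x d q ⟩
      d * c * A * q + d * (x * q)     ≤⟨ +-monoʳ-≤ (d * c * A * q) (*-monoʳ-≤ d lower) ⟩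
      d * c * A * q + d * (p * c)     ≡⟨ sym value ⟩
      (A * q + p) * 2 ^ (i + n)       ∎
    upper′ : (A * q + p) * 2 ^ (i + n) ≤ (num γ (i + n) + 1) * (d * q)
    upper′ = begin
      (A * q + p) * 2 ^ (i + n)       ≡⟨ value ⟩
      d * c * A * q + d * (p * c)     ≤⟨ +-monoʳ-≤ (d * c * A * q) (*-monoʳ-≤ d upper) ⟩
      d * c * A * q + d * ((x + 1) * q) ≡⟨ scaled-suc c A x d q ⟩
      (c * A + x + 1) * (d * q)       ≡⟨ cong (λ y → (y + 1) * (d * q)) (sym split) ⟩
      (num γ (i + n) + 1) * (d * q)   ∎

*-cancelˡ-≤-up-to : ∀ d k {a b} → k < d → d * a ≤ d * b + k → a ≤ b
*-cancelˡ-≤-up-to d k {a} {b} k<d da≤db+k = ≮⇒≥ λ b<a → <⇒≱ k<d (+-cancelˡ-≤ (d * b) d k (begin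
  d * b + d    ≡⟨ +-comm (d * b) d ⟩
  d + d * b    ≡⟨ sym (*-suc d b) ⟩
  d * suc b    ≤⟨ *-monoʳ-≤ d b<a ⟩
  d * a        ≤⟨ da≤db+k ⟩
  d * b + k    ∎))
  where open ≤-Reasoning

Close : ℕ → Stream → Stream → Set
Close K γ δ = ∀ n → (num γ n ≤ num δ n + K) × (num δ n ≤ num γ n + K)

close-trans : ∀ {K L γ δ ε} → Close K γ δ → Close L δ ε → Close (K + L) γ ε
close-trans {K} {L} {γ} {ε = ε} γ≈δ δ≈ε n =
  subst (λ M → num γ n ≤ num ε n + M) (+-comm L K)
    (chain (num ε n) (proj₁ (γ≈δ n)) (proj₁ (δ≈ε n))) ,
  chain (num γ n) (proj₂ (δ≈ε n)) (proj₂ (γ≈δ n))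
  where
    chain : ∀ {x y} z {A B} → x ≤ y + A → y ≤ z + B → x ≤ z + (B + A)
    chain z {A} {B} x≤y+A y≤z+B =
      ≤-trans x≤y+A (≤-trans (+-monoˡ-≤ A y≤z+B) (≤-reflexive (+-assoc z B A)))

represents-close : ∀ ω γ p q K → RepresentsRational ω p q → Close K ω γ → RepresentsRational γ p q
represents-close ω γ p q K (q>0 , ω-brackets) ω≈γ = q>0 , λ n →
  *-cancelˡ-≤-up-to d k (n<2^n k) (lower n) , *-cancelˡ-≤-up-to d k (n<2^n k) (upper n)
  where
    open ≤-Reasoning
    -- Compare at precision n + k: the error K q = k is below one unit 2 ^ k of precision n.
    k d : ℕ
    k = K * q
    d = 2 ^ k
    value : ∀ n → p * 2 ^ (n + k) ≡ d * (p * 2 ^ n)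
    value n = ≡.trans (cong (p *_) (^-distribˡ-+-* 2 n k)) (rotate p (2 ^ n) d)
      where
        rotate : ∀ p c d → p * (c * d) ≡ d * (p * c)
        rotate = solve-∀
    lower : ∀ n → d * (num γ n * q) ≤ d * (p * 2 ^ n) + k
    lower n = begin
      d * (num γ n * q)            ≡⟨ sym (*-assoc d (num γ n) q) ⟩
      d * num γ n * q              ≤⟨ *-monoˡ-≤ q (num-+-lower γ n k) ⟩
      num γ (n + k) * q            ≤⟨ *-monoˡ-≤ q (proj₂ (ω≈γ (n + k))) ⟩
      (num ω (n + k) + K) * q      ≡⟨ *-distribʳ-+ q (num ω (n + k)) K ⟩
      num ω (n + k) * q + k        ≤⟨ +-monoˡ-≤ k (proj₁ (ω-brackets (n + k))) ⟩
      p * 2 ^ (n + k) + k          ≡⟨ cong (_+ k) (value n) ⟩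
      d * (p * 2 ^ n) + k          ∎
    upper : ∀ n → d * (p * 2 ^ n) ≤ d * ((num γ n + 1) * q) + k
    upper n = begin
      d * (p * 2 ^ n)                   ≡⟨ sym (value n) ⟩
      p * 2 ^ (n + k)                   ≤⟨ proj₂ (ω-brackets (n + k)) ⟩
      (num ω (n + k) + 1) * q           ≤⟨ *-monoˡ-≤ q (+-monoˡ-≤ 1 (proj₁ (ω≈γ (n + k)))) ⟩
      (num γ (n + k) + K + 1) * q       ≡⟨ shift-slack (num γ (n + k)) K q ⟩
      (num γ (n + k) + 1) * q + k       ≤⟨ +-monoˡ-≤ k (*-monoˡ-≤ q (num-+-upper γ n k)) ⟩
      d * (num γ n + 1) * q + k         ≡⟨ cong (_+ k) (*-assoc d (num γ n + 1) q) ⟩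
      d * ((num γ n + 1) * q) + k       ∎
      where
        shift-slack : ∀ y K q → (y + K + 1) * q ≡ (y + 1) * q + K * q
        shift-slack = solve-∀

represents-same : ∀ α β p q → RepresentsRational α p q → RepresentsRational β p q → SameValue α β
represents-same α β p q (q>0 , α-brackets) (_ , β-brackets) n =
  below α-brackets β-brackets , below β-brackets α-brackets
  where
    below : ∀ {γ δ} → (∀ n → Bracket γ p q n) → (∀ n → Bracket δ p q n) → num γ n ≤ num δ n + 1
    below {γ} {δ} γ-brackets δ-brackets =
      *-cancelʳ-≤ (num γ n) (num δ n + 1) q {{>-nonZero q>0}}
        (≤-trans (proj₁ (γ-brackets n)) (proj₂ (δ-brackets n)))

Periodic : ℕ → Stream → Set
Periodic L γ = ∀ s → γ (s + L) ≡ γ s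

periodic-represents : ∀ γ l → Periodic (suc l) γ → RepresentsRational γ (num γ (suc l)) (2 ^ suc l ∸ 1)
periodic-represents γ l periodic = M>0 , λ n → bracket-≤ γ B M (m≤m*n n L) (brackets-at-multiples n)
  where
    L B M : ℕ
    L = suc l
    B = num γ L
    M = 2 ^ L ∸ 1
    1<2^L : 1 < 2 ^ L
    1<2^L = *-monoʳ-≤ 2 (m^n>0 2 l)
    M>0 : 0 < M
    M>0 = m<n⇒0<n∸m 1<2^L
    M+1≡2^L : M + 1 ≡ 2 ^ L
    M+1≡2^L = m∸n+n≡m (<⇒≤ 1<2^L)
    B≤M : B ≤ M
    B≤M = +-cancelʳ-≤ 1 B M (subst₂ _≤_ (+-comm 1 B) (sym M+1≡2^L) (num<2^n γ L))
    -- drop L γ is γ again, and (B M + B) / (2 ^ L M) = B / M as M + 1 = 2 ^ L.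
    bracket-shift : ∀ n → Bracket γ B M n → Bracket γ B M (L + n)
    bracket-shift n br = bracket-scale γ B M (2 ^ L) (L + n) {{m^n≢0 2 L}}
      (subst₂ (λ P Q → Bracket γ P Q (L + n)) B*M+B≡B*2^L (*-comm (2 ^ L) M)
        (bracket-drop γ L B M n (bracket-cong B M drop-periodic n br)))
      where
        drop-periodic : ∀ t → γ t ≡ drop L γ t
        drop-periodic t = sym (≡.trans (cong γ (+-comm L t)) (periodic t))
        B*M+B≡B*2^L : B * M + B ≡ B * 2 ^ L
        B*M+B≡B*2^L = ≡.trans (cong (B * M +_) (sym (*-identityʳ B)))
                        (≡.trans (sym (*-distribˡ-+ B M 1)) (cong (B *_) M+1≡2^L))
    brackets-at-multiples : ∀ k → Bracket γ B M (k * L)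
    brackets-at-multiples zero    = z≤n , subst₂ _≤_ (sym (*-identityʳ B)) (sym (+-identityʳ M)) B≤M
    brackets-at-multiples (suc k) = bracket-shift (k * L) (brackets-at-multiples k)

EventuallyPeriodic : Stream → Set
EventuallyPeriodic γ = ∃₂ λ i l → Periodic (suc l) (drop i γ)

eventually-periodic⇒rational : ∀ γ → EventuallyPeriodic γ → IsRationalValue γ
eventually-periodic⇒rational γ (i , l , periodic) =
  num γ i * M + B , 2 ^ i * M , *-mono-≤ (m^n>0 2 i) M>0 ,
  λ n → bracket-≤ γ (num γ i * M + B) (2 ^ i * M) (m≤n+m n i) (bracket-drop γ i B M n (tail-brackets n))
  where
    B M : ℕ
    B = num (drop i γ) (suc l)
    M = 2 ^ suc l ∸ 1
    tail-represents : RepresentsRational (drop i γ) B M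
    tail-represents = periodic-represents (drop i γ) l periodic
    M>0 : 0 < M
    M>0 = proj₁ tail-represents
    tail-brackets : ∀ n → Bracket (drop i γ) B M n
    tail-brackets = proj₂ tail-represents

module LongDivision (p q : ℕ) where

  digit : ℕ → Bool
  digit r = q ≤ᵇ 2 * r

  next : ℕ → ℕ
  next r = 2 * r ∸ bit (digit r) * q

  remainder : ℕ → ℕ
  remainder zero    = p
  remainder (suc n) = next (remainder n)

  expansion : Stream
  expansion n = digit (remainder n)

  digit-step : ∀ r → r ≤ q → bit (digit r) * q ≤ 2 * r × next r ≤ q
  digit-step r r≤q with q ≤ᵇ 2 * r | ≤ᵇ-reflects-≤ q (2 * r)
  ... | true  | ofʸ q≤2r = subst (_≤ 2 * r) (sym (*-identityˡ q)) q≤2r , (begin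
          2 * r ∸ 1 * q ≤⟨ ∸-mono (*-monoʳ-≤ 2 r≤q) (≤-reflexive (sym (*-identityˡ q))) ⟩
          2 * q ∸ q     ≡⟨ cong (λ y → q + y ∸ q) (+-identityʳ q) ⟩
          q + q ∸ q     ≡⟨ m+n∸m≡n q q ⟩
          q             ∎)
    where open ≤-Reasoning
  ... | false | ofⁿ q≰2r = z≤n , <⇒≤ (≰⇒> q≰2r)

  division-invariant : p ≤ q → ∀ n → num expansion n * q + remainder n ≡ p * 2 ^ n × remainder n ≤ q
  division-invariant p≤q zero    = sym (*-identityʳ p) , p≤q
  division-invariant p≤q (suc n) = invariant , proj₂ (digit-step r r≤q)
    where
      open ≡-Reasoning
      N r b : ℕ
      N = num expansion n
      r = remainder n
      b = bit (digit r)
      r≤q : r ≤ q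
      r≤q = proj₂ (division-invariant p≤q n)
      bq≤2r : b * q ≤ 2 * r
      bq≤2r = proj₁ (digit-step r r≤q)
      invariant : (2 * N + b) * q + (2 * r ∸ b * q) ≡ p * 2 ^ suc n
      invariant = begin
        (2 * N + b) * q + (2 * r ∸ b * q)     ≡⟨ regroup (2 * N) b q (2 * r ∸ b * q) ⟩
        2 * N * q + (b * q + (2 * r ∸ b * q)) ≡⟨ cong (2 * N * q +_) (m+[n∸m]≡n bq≤2r) ⟩
        2 * N * q + 2 * r                     ≡⟨ double-sum N q r ⟩
        2 * (N * q + r)                       ≡⟨ cong (2 *_) (proj₁ (division-invariant p≤q n)) ⟩
        2 * (p * 2 ^ n)                       ≡⟨ x∙yz≈y∙xz 2 p (2 ^ n) ⟩
        p * 2 ^ suc n                         ∎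
        where
          regroup : ∀ x b q y → (x + b) * q + y ≡ x * q + (b * q + y)
          regroup = solve-∀
          double-sum : ∀ N q r → 2 * N * q + 2 * r ≡ 2 * (N * q + r)
          double-sum = solve-∀

  expansion-represents : p ≤ q → 0 < q → RepresentsRational expansion p q
  expansion-represents p≤q q>0 = q>0 , λ n →
    let (invariant , r≤q) = division-invariant p≤q n in
    subst (num expansion n * q ≤_) invariant (m≤m+n _ _) ,
    subst (_≤ (num expansion n + 1) * q) invariant
      (≤-trans (+-monoʳ-≤ (num expansion n * q) r≤q) (≤-reflexive (distrib-suc (num expansion n) q)))
    where
      distrib-suc : ∀ N q → N * q + q ≡ (N + 1) * q
      distrib-suc = solve-∀

repetition : ∀ {K N} (x : ℕ → ℕ) (s : ℕ → Fin N) → (∀ t → x t ≤ K) →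
             ∃₂ λ i l → x i ≡ x (i + suc l) × s i ≡ s (i + suc l)
repetition {K} {N} x s bounded
  with Fin.pigeonhole (n<1+n (suc K * N))
         (λ t → combine (fromℕ< (s≤s (bounded (toℕ t)))) (s (toℕ t)))
... | i , j , i<j , same-code = toℕ i , l , same-x , same-s
  where
    x-code : ∀ t → Fin (suc K)
    x-code t = fromℕ< (s≤s (bounded t))
    same-parts : x-code (toℕ i) ≡ x-code (toℕ j) × s (toℕ i) ≡ s (toℕ j)
    same-parts =
      Fin.combine-injective (x-code (toℕ i)) (s (toℕ i)) (x-code (toℕ j)) (s (toℕ j)) same-code
    l : ℕ
    l = toℕ j ∸ suc (toℕ i)
    j≡ : toℕ i + suc l ≡ toℕ j
    j≡ = ≡.trans (+-suc (toℕ i) l) (m+[n∸m]≡n i<j)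
    same-x : x (toℕ i) ≡ x (toℕ i + suc l)
    same-x = begin
      x (toℕ i)   ≡⟨ sym (Fin.toℕ-fromℕ< _) ⟩
      toℕ (x-code (toℕ i)) ≡⟨ cong toℕ (proj₁ same-parts) ⟩
      toℕ (x-code (toℕ j)) ≡⟨ Fin.toℕ-fromℕ< _ ⟩
      x (toℕ j)   ≡⟨ cong x (sym j≡) ⟩
      x (toℕ i + suc l) ∎
      where open ≡-Reasoning
    same-s : s (toℕ i) ≡ s (toℕ i + suc l)
    same-s = ≡.trans (proj₂ same-parts) (cong s (sym j≡))

module Pumping (T : Transducer) {β ω : Stream} (R : Run T β ω)
  (x : ℕ → ℕ) (x-next : ∀ m n → x m ≡ x n → x (suc m) ≡ x (suc n))
  (β-det : ∀ m n → x m ≡ x n → β m ≡ β n)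
  (I l : ℕ)
  (x-loop : x (delay T + I) ≡ x (delay T + (I + suc l)))
  (state-loop : Run.state R (delay T + I) ≡ Run.state R (delay T + (I + suc l)))
  where

  private
    D a e : ℕ
    D = delay T
    a = D + I
    e = D + (I + suc l)
    state : ℕ → Fin (nStates T)
    state = Run.state R

    e≡suc : e ≡ suc (a + l)
    e≡suc = ≡.trans (sym (+-assoc D I (suc l))) (+-suc a l)

    a<e : a < e
    a<e = subst (a <_) (sym e≡suc) (s≤s (m≤m+n a l))

  -- The pumped run is at time t where the original run is at time fold t:
  -- the original up to e, then forever jumping back from e to a.
  fold-step : ℕ → ℕ
  fold-step y with suc y ≟ e
  ... | yes _ = a
  ... | no  _ = suc y

  fold : ℕ → ℕ
  fold zero    = zero
  fold (suc t) = fold-step (fold t)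

  fold-below : ∀ t → t < e → fold t ≡ t
  fold-below zero    _     = refl
  fold-below (suc t) suc-t<e = ≡.trans (cong fold-step (fold-below t (<-trans (n<1+n t) suc-t<e))) step
    where
      step : fold-step t ≡ suc t
      step with suc t ≟ e
      ... | yes suc-t≡e = contradiction suc-t≡e (<⇒≢ suc-t<e)
      ... | no  _       = refl

  fold-end : fold e ≡ a
  fold-end = ≡.trans (cong fold e≡suc) (≡.trans (cong fold-step (fold-below (a + l) a+l<e)) step)
    where
      a+l<e : a + l < e
      a+l<e = subst (a + l <_) (sym e≡suc) (n<1+n (a + l))
      step : fold-step (a + l) ≡ a
      step with suc (a + l) ≟ e
      ... | yes _     = refl
      ... | no  suc≢e = contradiction (sym e≡suc) suc≢e

  fold-periodic : ∀ m → fold (e + m) ≡ fold (a + m)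
  fold-periodic zero    = begin
    fold (e + 0) ≡⟨ cong fold (+-identityʳ e) ⟩
    fold e       ≡⟨ fold-end ⟩
    a            ≡⟨ sym (fold-below a a<e) ⟩
    fold a       ≡⟨ cong fold (sym (+-identityʳ a)) ⟩
    fold (a + 0) ∎
    where open ≡-Reasoning
  fold-periodic (suc m) = begin
    fold (e + suc m)           ≡⟨ cong fold (+-suc e m) ⟩
    fold-step (fold (e + m))   ≡⟨ cong fold-step (fold-periodic m) ⟩
    fold-step (fold (a + m))   ≡⟨ cong fold (sym (+-suc a m)) ⟩
    fold (a + suc m)           ∎
    where open ≡-Reasoning

  delay≤fold : ∀ m → D ≤ fold (D + m)
  delay≤fold zero    = subst (D ≤_) (sym (fold-below (D + 0) (≤-<-trans (+-monoʳ-≤ D z≤n) a<e))) (m≤m+n D 0)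
  delay≤fold (suc m) = subst (λ t → D ≤ fold t) (sym (+-suc D m)) (step (fold (D + m)) (delay≤fold m))
    where
      step : ∀ y → D ≤ y → D ≤ fold-step y
      step y D≤y with suc y ≟ e
      ... | yes _ = m≤m+n D I
      ... | no  _ = m≤n⇒m≤1+n D≤y

  x-fold : ∀ t → x (fold t) ≡ x t
  x-fold zero    = refl
  x-fold (suc t) = step (fold t) (x-fold t)
    where
      step : ∀ y → x y ≡ x t → x (fold-step y) ≡ x (suc t)
      step y xy≡xt with suc y ≟ e
      ... | yes suc-y≡e = ≡.trans x-loop (≡.trans (cong x (sym suc-y≡e)) (x-next y t xy≡xt))
      ... | no  _       = x-next y t xy≡xt

  state-fold-step : ∀ y → state (fold-step y) ≡ state (suc y)
  state-fold-step y with suc y ≟ e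
  ... | yes suc-y≡e = ≡.trans state-loop (cong state (sym suc-y≡e))
  ... | no  _       = refl

  pumped : Stream
  pumped s = ω (fold (D + s) ∸ D)

  pumped-run : Run T β pumped
  pumped-run = record
    { state   = state ∘ fold
    ; start   = Run.start R
    ; silent  = silent
    ; writing = writing
    }
    where
      silent : ∀ t → t < D → trans T (state (fold t)) (β t) nothing (state (fold (suc t))) ≡ true
      silent t t<D = subst₂ (λ u v → trans T (state u) (β t) nothing (state v) ≡ true)
        (sym (fold-below t (<-trans t<D early)))
        (sym (fold-below (suc t) (≤-<-trans t<D early)))
        (Run.silent R t t<D)
        where
          early : D < e
          early = ≤-<-trans (m≤m+n D I) a<e
      writing : ∀ s → trans T (state (fold (D + s))) (β (D + s)) (just (pumped s))
                              (state (fold (suc (D + s)))) ≡ true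
      writing s = subst₂ (λ b v → trans T (state u) b (just (ω (u ∸ D))) v ≡ true)
        (β-det u (D + s) (x-fold (D + s))) (sym (state-fold-step u))
        (subst (λ v → trans T (state v) (β v) (just (ω (u ∸ D))) (state (suc v)) ≡ true)
          (m+[n∸m]≡n (delay≤fold s)) (Run.writing R (u ∸ D)))
        where
          u : ℕ
          u = fold (D + s)

  pumped-periodic : Periodic (suc l) (drop I pumped)
  pumped-periodic s = cong (λ t → ω (t ∸ D)) (begin
    fold (D + (I + (s + suc l))) ≡⟨ cong fold (regroup D I s (suc l)) ⟩
    fold (e + s)                 ≡⟨ fold-periodic s ⟩
    fold (a + s)                 ≡⟨ cong fold (+-assoc D I s) ⟩
    fold (D + (I + s))           ∎)
    where
      open ≡-Reasoning
      regroup : ∀ D I s L → D + (I + (s + L)) ≡ D + (I + L) + s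
      regroup = solve-∀

eventually-periodic-run : ∀ T {β ω} K → Run T β ω → (x : ℕ → ℕ) → (∀ t → x t ≤ K) →
  (∀ m n → x m ≡ x n → x (suc m) ≡ x (suc n)) → (∀ m n → x m ≡ x n → β m ≡ β n) →
  Σ Stream λ ω′ → Run T β ω′ × EventuallyPeriodic ω′
eventually-periodic-run T K R x bounded x-next β-det
  with repetition (x ∘ (delay T +_)) (Run.state R ∘ (delay T +_)) (bounded ∘ (delay T +_))
... | I , l , x-loop , state-loop = pumped , pumped-run , I , l , pumped-periodic
  where open Pumping T R x x-next β-det I l x-loop state-loop

numerator≤denominator : ∀ {α p q} → RepresentsRational α p q → p ≤ q
numerator≤denominator {p = p} {q} (_ , brackets) =
  subst₂ _≤_ (*-identityʳ p) (*-identityˡ q) (proj₂ (brackets 0))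

proposition2p8 : (T : Transducer) (f : Stream → Stream) →
    IsRealFunction f → Computes T f →
    ∀ α → IsRationalValue α → IsRationalValue (f α)
proposition2p8 T f f-real T-computes α (p , q , α-represents) =
  let (ω , run)                 = proj₁ (T-computes expansion)
      (ω′ , run′ , periodic)    = eventually-periodic-run T q run remainder remainder≤q
                                    (λ _ _ → cong next) (λ _ _ → cong digit)
      (P , Q , ω′-represents)   = eventually-periodic⇒rational ω′ periodic
      ω′≈fα : Close 2 ω′ (f α)
      ω′≈fα = close-trans (proj₂ (T-computes expansion) ω′ run′) (f-real expansion α expansion≈α)
  in P , Q , represents-close ω′ (f α) P Q 2 ω′-represents ω′≈fα
  where
    p≤q : p ≤ q
    p≤q = numerator≤denominator α-represents
    open LongDivision p q
    expansion≈α : SameValue expansion α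
    expansion≈α =
      represents-same expansion α p q (expansion-represents p≤q (proj₁ α-represents)) α-represents
    remainder≤q : ∀ t → remainder t ≤ q
    remainder≤q t = proj₂ (division-invariant p≤q t)
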